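{- Let $G$ be a bipartite graph with bipartition $\{B,R\}$, where $m:=|B|\ge 1$, $n:=|R|\ge 1$ and $m\le n$, and let $k$ be an integer with $1\le k\le m+n-1$. If $G$ has a perfect matching and $k$ is odd, then $\beta(F_k(G))=\binom{m+n}{k}/2$.
   Context: For a simple finite graph $G$ of order $N$ and an integer $1\le k\le N-1$, the $k$-token graph $F_k(G)$ is the graph whose vertices are all $k$-element subsets of $V(G)$, two such subsets being adjacent iff their symmetric difference is an edge of $G$. $\beta$ denotes the independence number. A perfect matching is a matching covering every vertex. -}

module Defs where

open import Data.Nat using (ℕ; _<_; _≤_)
open import Data.Fin using (Fin; toℕ)
open import Data.Fin.Subset using (Subset; _∈_; _∉_; ∣_∣)
open import Data.Product using (Σ; _×_)
open import Data.List using (List; length)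
open import Data.List.Relation.Unary.All using (All)
open import Data.List.Relation.Unary.Unique.Propositional using (Unique)
open import Data.List.Membership.Propositional using () renaming (_∈_ to _∈ₗ_)
open import Relation.Nullary using (¬_)
open import Relation.Binary.PropositionalEquality using (_≡_; _≢_)
open import Relation.Binary using (Decidable)
open import Function.Bundles using (_⇔_)

record Graph (N : ℕ) : Set₁ where
  field
    Adj     : Fin N → Fin N → Set
    adj?    : Decidable Adj
    sym     : ∀ {u v} → Adj u v → Adj v u
    irrefl  : ∀ {u} → ¬ Adj u u
open Graph public

-- G on Fin (m + n) is bipartite with parts B = {i | toℕ i < m} (|B| = m)
-- and R = {i | m ≤ toℕ i} (|R| = n): every edge joins B and R.
IsBipartiteWith : (m n : ℕ) → Graph (m Data.Nat.+ n) → Set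
IsBipartiteWith m n G =
  ∀ u v → Adj G u v → (toℕ u < m × m ≤ toℕ v) Data.Sum.⊎ (m ≤ toℕ u × toℕ v < m)
  where import Data.Sum

-- A perfect matching: an involution pairing every vertex with a neighbour
-- (the matching edges are {v , μ v}; each vertex is covered exactly once).
record PerfectMatching {N : ℕ} (G : Graph N) : Set where
  field
    μ        : Fin N → Fin N
    invol    : ∀ v → μ (μ v) ≡ v
    matched  : ∀ v → Adj G v (μ v)

-- Adjacency in the k-token graph: the symmetric difference of A and B is
-- exactly {u , v} with uv an edge of G (u ∈ A ∖ B, v ∈ B ∖ A).
TokenAdj : {N : ℕ} → Graph N → Subset N → Subset N → Set
TokenAdj {N} G A B =
  Σ (Fin N) λ u → Σ (Fin N) λ v →
    Adj G u v × u ∈ A × u ∉ B × v ∈ B × v ∉ A ×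
    (∀ w → w ≢ u → w ≢ v → (w ∈ A ⇔ w ∈ B))

record IndepSetTok {N : ℕ} (G : Graph N) (k : ℕ) (S : List (Subset N)) : Set where
  field
    unique   : Unique S
    tokens   : All (λ A → ∣ A ∣ ≡ k) S
    indep    : ∀ {A B} → A ∈ₗ S → B ∈ₗ S → ¬ TokenAdj G A B

IndepNumberTok : {N : ℕ} → Graph N → ℕ → ℕ → Set
IndepNumberTok {N} G k b =
  Σ (List (Subset N)) (λ S → IndepSetTok G k S × length S ≡ b) ×
  (∀ S → IndepSetTok G k S → length S ≤ b)

-- Upper bound: for odd k no k-subset A is a union of edges of the perfect matching μ, so
-- there is a first matching edge meeting A in exactly one vertex, and moving that token
-- across the edge gives an F_k(G)-neighbour of A. This switch is an involution (it does
-- not change which matching edges are unbalanced), so an independent set S and its image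
-- are disjoint sets of k-subsets, and 2|S| ≤ C(m+n, k).
-- Lower bound: every edge of G joins B to R, so a token move changes the parity of
-- |A ∩ B|; both parity classes of k-subsets are independent, and since each has at most
-- half of the k-subsets by the upper bound, the even one has exactly half.
module Submission where

open import Defs hiding (sym)
import Algebra.Properties.CommutativeMonoid.Sum as Sum
open import Data.Bool using (Bool; true; false; not; _∧_; _xor_; if_then_else_)
open import Data.Bool.Properties using (∧-identityʳ; ∧-zeroʳ; xor-comm; ¬-not)
open import Data.Empty using (⊥-elim)
open import Data.Fin using (Fin; zero; suc; toℕ; _≟_)
open import Data.Fin.Permutation using (Permutation; permutation)
open import Data.Fin.Properties using (_<?_; <-cmp; suc-injective)
open import Data.Fin.Subset using (Subset; ∣_∣) renaming (_∈_ to _∈ₛ_; _∉_ to _∉ₛ_)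
open import Data.List using (List; []; _∷_; _++_; map; length; filter)
open import Data.List.Membership.Propositional using (_∈_)
open import Data.List.Membership.Propositional.Properties
  using (∈-∃++; ∈-++⁻; ∈-++⁺ˡ; ∈-++⁺ʳ; ∈-map⁺; ∈-map⁻; ∈-filter⁺; ∈-filter⁻)
open import Data.List.Properties using (length-++; length-map; length-++-sucʳ)
open import Data.List.Relation.Binary.Subset.Propositional using (_⊆_)
open import Data.List.Relation.Unary.All as All using (All)
open import Data.List.Relation.Unary.All.Properties using (filter⁺)
open import Data.List.Relation.Unary.AllPairs using ([]; _∷_)
open import Data.List.Relation.Unary.Any using (here; there)
open import Data.List.Relation.Unary.Unique.Propositional using (Unique)
import Data.List.Relation.Unary.Unique.Propositional.Properties as Unique
open import Data.Maybe using (Maybe; just; nothing)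
import Data.Maybe as Maybe
open import Data.Nat using (ℕ; zero; suc; pred; _+_; _*_; _∸_; _≤_; _/_; _%_; z≤n; s≤s; parity)
open import Data.Nat.Combinatorics using (_C_; nCk+nC[k+1]≡[n+1]C[k+1])
open import Data.Nat.DivMod using (m*n/n≡m; m/n*n≤m; /-monoˡ-≤)
open import Data.Nat.Properties
  using (+-0-commutativeMonoid; +-commutativeSemigroup; +-assoc; +-comm; +-identityʳ; *-comm;
         +-cancelʳ-≡; +-cancelʳ-≤; +-monoʳ-≤; ≤-antisym; ≤⇒≯; module ≤-Reasoning)
  renaming (_<?_ to _<ℕ?_)
open import Data.Parity using (Parity; 0ℙ; 1ℙ)
import Data.Parity.Base as ℙ
open import Data.Parity.Properties using (+-homo-+; +-inverse; +-cancelˡ-≡)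
  renaming (_≟_ to _≟ℙ_)
open import Data.Product using (∃; ∃₂; _×_; _,_; proj₁; proj₂)
open import Data.Sum using (_⊎_; inj₁; inj₂)
open import Data.Vec using ([]; _∷_; lookup; tabulate; _[_]≔_)
open import Data.Vec.Functional using (updateAt)
open import Data.Vec.Functional.Properties using (updateAt-updates; updateAt-minimal)
open import Data.Vec.Properties
  using (∷-injectiveʳ; []=⇒lookup; lookup⇒[]=; tabulate∘lookup; tabulate-cong; lookup∘update; lookup∘update′)
open import Function using (_∘_; _⇔_; mk⇔; Equivalence)
open import Relation.Binary using (tri<; tri≈; tri>)
open import Relation.Binary.PropositionalEquality
open import Relation.Nullary using (¬_; Dec; does; yes; no; contradiction)
open import Relation.Nullary.Decidable using (dec-true; dec-false)

open Sum +-0-commutativeMonoid using (sum; sum-cong-≗; ∑-distrib-+; ∑-permute)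
open import Algebra.Properties.CommutativeSemigroup +-commutativeSemigroup
  using (xy∙z≈zy∙x; xy∙z≈xz∙y; xy∙z≈x∙zy)

bit : Bool → ℕ
bit true  = 1
bit false = 0

count : ∀ {N} → (Fin N → Bool) → ℕ
count f = sum (bit ∘ f)

count-cong : ∀ {N} {f g : Fin N → Bool} → (∀ x → f x ≡ g x) → count f ≡ count g
count-cong f≗g = sum-cong-≗ (cong bit ∘ f≗g)

count-update : ∀ {N} {f g : Fin N → Bool} u → (∀ x → x ≢ u → f x ≡ g x) →
               count f + bit (g u) ≡ count g + bit (f u)
count-update {suc N} {f} {g} zero f≗g = begin
  bit (f zero) + count (f ∘ suc) + bit (g zero) ≡⟨ xy∙z≈zy∙x (bit (f zero)) _ _ ⟩
  bit (g zero) + count (f ∘ suc) + bit (f zero) ≡⟨ cong (λ s → bit (g zero) + s + bit (f zero)) tails ⟩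
  bit (g zero) + count (g ∘ suc) + bit (f zero) ∎
  where
  open ≡-Reasoning
  tails = count-cong (λ x → f≗g (suc x) λ ())
count-update {suc N} {f} {g} (suc u) f≗g = begin
  bit (f zero) + count (f ∘ suc) + bit (g (suc u))   ≡⟨ +-assoc (bit (f zero)) _ _ ⟩
  bit (f zero) + (count (f ∘ suc) + bit (g (suc u))) ≡⟨ cong₂ _+_ (cong bit (f≗g zero λ ())) tails ⟩
  bit (g zero) + (count (g ∘ suc) + bit (f (suc u))) ≡⟨ +-assoc (bit (g zero)) _ _ ⟨
  bit (g zero) + count (g ∘ suc) + bit (f (suc u))   ∎
  where
  open ≡-Reasoning
  tails = count-update u (λ x x≢u → f≗g (suc x) (x≢u ∘ suc-injective))

count-exchange : ∀ {N} {f g : Fin N → Bool} {u v} → u ≢ v → (∀ x → x ≢ u → x ≢ v → f x ≡ g x) →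
                 count f + (bit (g u) + bit (g v)) ≡ count g + (bit (f u) + bit (f v))
count-exchange {f = f} {g} {u} {v} u≢v f≗g = begin
  count f + (bit (g u) + bit (g v)) ≡⟨ +-assoc (count f) _ _ ⟨
  count f + bit (g u) + bit (g v)   ≡⟨ cong (λ a → count f + bit a + bit (g v)) (updateAt-updates u f) ⟨
  count f + bit (h u) + bit (g v)   ≡⟨ cong (_+ bit (g v)) (count-update u f≗h) ⟩
  count h + bit (f u) + bit (g v)   ≡⟨ xy∙z≈xz∙y (count h) _ _ ⟩
  count h + bit (g v) + bit (f u)   ≡⟨ cong (_+ bit (f u)) (count-update v h≗g) ⟩
  count g + bit (h v) + bit (f u)   ≡⟨ cong (λ a → count g + bit a + bit (f u)) (updateAt-minimal v u f (u≢v ∘ sym)) ⟩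
  count g + bit (f v) + bit (f u)   ≡⟨ xy∙z≈x∙zy (count g) _ _ ⟩
  count g + (bit (f u) + bit (f v)) ∎
  where
  open ≡-Reasoning
  h = updateAt f u (λ _ → g u)
  f≗h : ∀ x → x ≢ u → f x ≡ h x
  f≗h x x≢u = sym (updateAt-minimal x u f x≢u)
  h≗g : ∀ x → x ≢ v → h x ≡ g x
  h≗g x x≢v with x ≟ u
  ... | yes refl = updateAt-updates x f
  ... | no x≢u   = trans (updateAt-minimal x u f x≢u) (f≗g x x≢u x≢v)

bit-split : ∀ b c → bit b ≡ bit (b ∧ c) + bit (b ∧ not c)
bit-split false c     = refl
bit-split true  true  = refl
bit-split true  false = refl

parity-double : ∀ n → parity (n + n) ≡ 0ℙ
parity-double n = trans (+-homo-+ n n) (proj₁ +-inverse (parity n))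

first : ∀ {N} → (Fin N → Bool) → Maybe (Fin N)
first {zero}  f = nothing
first {suc N} f = if f zero then just zero else Maybe.map suc (first (f ∘ suc))

first-cong : ∀ {N} {f g : Fin N → Bool} → (∀ x → f x ≡ g x) → first f ≡ first g
first-cong {zero}  f≗g = refl
first-cong {suc N} f≗g rewrite f≗g zero | first-cong (f≗g ∘ suc) = refl

first-just : ∀ {N} {f : Fin N → Bool} {w} → first f ≡ just w → f w ≡ true
first-just {suc N} {f} eq with f zero in f₀ | first (f ∘ suc) in eq′
first-just {suc N} {f} refl | true  | _      = f₀
first-just {suc N} {f} refl | false | just w = first-just eq′

first-nothing : ∀ {N} {f : Fin N → Bool} → first f ≡ nothing → ∀ x → f x ≡ false
first-nothing {suc N} {f} eq x with f zero in f₀ | first (f ∘ suc) in eq′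
first-nothing {suc N} {f} refl zero    | false | nothing = f₀
first-nothing {suc N} {f} refl (suc x) | false | nothing = first-nothing eq′ x

lookup-ext : ∀ {N} {A B : Subset N} → (∀ x → lookup A x ≡ lookup B x) → A ≡ B
lookup-ext {A = A} {B} A≗B =
  trans (sym (tabulate∘lookup A)) (trans (tabulate-cong A≗B) (tabulate∘lookup B))

∣A∣≡count : ∀ {N} (A : Subset N) → ∣ A ∣ ≡ count (lookup A)
∣A∣≡count []          = refl
∣A∣≡count (true  ∷ A) = cong suc (∣A∣≡count A)
∣A∣≡count (false ∷ A) = ∣A∣≡count A

∉⇒lookup≡false : ∀ {N} {A : Subset N} {x} → x ∉ₛ A → lookup A x ≡ false
∉⇒lookup≡false {A = A} {x} x∉A = ¬-not (x∉A ∘ lookup⇒[]= x A)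

lookup≡false⇒∉ : ∀ {N} {A : Subset N} {x} → lookup A x ≡ false → x ∉ₛ A
lookup≡false⇒∉ A[x] x∈A with trans (sym ([]=⇒lookup x∈A)) A[x]
... | ()

⇔⇒lookup≡ : ∀ {N} {A B : Subset N} {x} → (x ∈ₛ A ⇔ x ∈ₛ B) → lookup A x ≡ lookup B x
⇔⇒lookup≡ {A = A} {B} {x} A⇔B with lookup A x in A[x] | lookup B x in B[x]
... | true  | true  = refl
... | false | false = refl
... | true  | false = contradiction (Equivalence.to A⇔B (lookup⇒[]= x A A[x])) (lookup≡false⇒∉ B[x])
... | false | true  = contradiction (Equivalence.from A⇔B (lookup⇒[]= x B B[x])) (lookup≡false⇒∉ A[x])

lookup≡⇒⇔ : ∀ {N} {A B : Subset N} {x} → lookup A x ≡ lookup B x → (x ∈ₛ A ⇔ x ∈ₛ B)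
lookup≡⇒⇔ {A = A} {B} {x} A[x]≡B[x] =
  mk⇔ (λ x∈A → lookup⇒[]= x B (trans (sym A[x]≡B[x]) ([]=⇒lookup x∈A)))
      (λ x∈B → lookup⇒[]= x A (trans A[x]≡B[x] ([]=⇒lookup x∈B)))

record TokenMove {N} (A B : Subset N) (u v : Fin N) : Set where
  field
    A[u]      : lookup A u ≡ true
    B[u]      : lookup B u ≡ false
    B[v]      : lookup B v ≡ true
    A[v]      : lookup A v ≡ false
    elsewhere : ∀ x → x ≢ u → x ≢ v → lookup A x ≡ lookup B x

  u≢v : u ≢ v
  u≢v refl with trans (sym A[u]) A[v]
  ... | ()

colourCount : ∀ {N} → (Fin N → Bool) → Subset N → ℕ
colourCount c A = count (λ x → c x ∧ lookup A x)

move-colourCount : ∀ {N} {A B : Subset N} {u v} → TokenMove A B u v → ∀ c →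
                   colourCount c A + bit (c v) ≡ colourCount c B + bit (c u)
move-colourCount {A = A} {B} {u} {v} move c = begin
  colourCount c A + bit (c v)
    ≡⟨ cong (colourCount c A +_) (cong₂ (λ a b → bit a + bit b) c∧B[u] c∧B[v]) ⟨
  colourCount c A + (bit (c u ∧ lookup B u) + bit (c v ∧ lookup B v))
    ≡⟨ count-exchange u≢v (λ x x≢u x≢v → cong (c x ∧_) (elsewhere x x≢u x≢v)) ⟩
  colourCount c B + (bit (c u ∧ lookup A u) + bit (c v ∧ lookup A v))
    ≡⟨ cong (colourCount c B +_) (cong₂ (λ a b → bit a + bit b) c∧A[u] c∧A[v]) ⟩
  colourCount c B + (bit (c u) + 0)
    ≡⟨ cong (colourCount c B +_) (+-identityʳ (bit (c u))) ⟩
  colourCount c B + bit (c u)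
    ∎
  where
  open ≡-Reasoning
  open TokenMove move
  c∧A[u] = trans (cong (c u ∧_) A[u]) (∧-identityʳ (c u))
  c∧A[v] = trans (cong (c v ∧_) A[v]) (∧-zeroʳ (c v))
  c∧B[u] = trans (cong (c u ∧_) B[u]) (∧-zeroʳ (c u))
  c∧B[v] = trans (cong (c v ∧_) B[v]) (∧-identityʳ (c v))

move-preserves-size : ∀ {N} {A B : Subset N} {u v} → TokenMove A B u v → ∣ A ∣ ≡ ∣ B ∣
move-preserves-size {A = A} {B} move = begin
  ∣ A ∣                          ≡⟨ ∣A∣≡count A ⟩
  colourCount (λ _ → true) A     ≡⟨ +-cancelʳ-≡ _ _ _ (move-colourCount move (λ _ → true)) ⟩
  colourCount (λ _ → true) B     ≡⟨ ∣A∣≡count B ⟨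
  ∣ B ∣                          ∎
  where open ≡-Reasoning

parity∘bit-injective : ∀ {a b} → parity (bit a) ≡ parity (bit b) → a ≡ b
parity∘bit-injective {true}  {true}  _ = refl
parity∘bit-injective {false} {false} _ = refl

move-flips-colourParity : ∀ {N} {A B : Subset N} {u v} → TokenMove A B u v → ∀ c → c u ≢ c v →
                          parity (colourCount c A) ≢ parity (colourCount c B)
move-flips-colourParity {A = A} {B} {u} {v} move c cu≢cv same =
  cu≢cv (sym (parity∘bit-injective (+-cancelˡ-≡ (parity (colourCount c A)) _ _ shifted)))
  where
  open ≡-Reasoning
  shifted : parity (colourCount c A) ℙ.+ parity (bit (c v)) ≡ parity (colourCount c A) ℙ.+ parity (bit (c u))
  shifted = begin
    parity (colourCount c A) ℙ.+ parity (bit (c v)) ≡⟨ +-homo-+ (colourCount c A) _ ⟨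
    parity (colourCount c A + bit (c v))            ≡⟨ cong parity (move-colourCount move c) ⟩
    parity (colourCount c B + bit (c u))            ≡⟨ +-homo-+ (colourCount c B) _ ⟩
    parity (colourCount c B) ℙ.+ parity (bit (c u)) ≡⟨ cong (ℙ._+ _) same ⟨
    parity (colourCount c A) ℙ.+ parity (bit (c u)) ∎

module _ {N} (G : Graph N) where

  tokenAdj⇒move : ∀ {A B} → TokenAdj G A B → ∃₂ λ u v → Adj G u v × TokenMove A B u v
  tokenAdj⇒move (u , v , uv , u∈A , u∉B , v∈B , v∉A , A⇔B) = u , v , uv , record
    { A[u]      = []=⇒lookup u∈A
    ; B[u]      = ∉⇒lookup≡false u∉B
    ; B[v]      = []=⇒lookup v∈B
    ; A[v]      = ∉⇒lookup≡false v∉A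
    ; elsewhere = λ x x≢u x≢v → ⇔⇒lookup≡ (A⇔B x x≢u x≢v)
    }

  move⇒tokenAdj : ∀ {A B u v} → Adj G u v → TokenMove A B u v → TokenAdj G A B
  move⇒tokenAdj {A} {B} {u} {v} uv move =
    u , v , uv , lookup⇒[]= u A A[u] , lookup≡false⇒∉ B[u] , lookup⇒[]= v B B[v] , lookup≡false⇒∉ A[v] ,
    λ x x≢u x≢v → lookup≡⇒⇔ (elsewhere x x≢u x≢v)
    where open TokenMove move

  tokenAdj-size : ∀ {A B} → TokenAdj G A B → ∣ A ∣ ≡ ∣ B ∣
  tokenAdj-size adj = let _ , _ , _ , move = tokenAdj⇒move adj in move-preserves-size move

module FixedPointFreeInvolution {N} (μ : Fin N → Fin N) (μ-involutive : ∀ x → μ (μ x) ≡ x)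
                                 (μ-fixfree : ∀ x → μ x ≢ x) where

  μ-injective : ∀ {x y} → μ x ≡ μ y → x ≡ y
  μ-injective {x} {y} μx≡μy = trans (sym (μ-involutive x)) (trans (cong μ μx≡μy) (μ-involutive y))

  precedesPartner : Fin N → Bool
  precedesPartner x = does (x <? μ x)

  precedesPartner-μ : ∀ x → not (precedesPartner (μ x)) ≡ precedesPartner x
  precedesPartner-μ x rewrite μ-involutive x with <-cmp x (μ x)
  ... | tri< x<μx _ μx≮x = trans (cong not (dec-false (μ x <? x) μx≮x)) (sym (dec-true (x <? μ x) x<μx))
  ... | tri≈ _ x≡μx _    = ⊥-elim (μ-fixfree x (sym x≡μx))
  ... | tri> x≮μx _ μx<x = trans (cong not (dec-true (μ x <? x) μx<x)) (sym (dec-false (x <? μ x) x≮μx))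

  -- Split the count by whether x precedes μ x; reindexing along μ swaps the two halves.
  count-μ-invariant : ∀ {f} → (∀ x → f (μ x) ≡ f x) →
                      let h = count (λ x → f x ∧ precedesPartner x) in count f ≡ h + h
  count-μ-invariant {f} f∘μ≗f = begin
    count f                                              ≡⟨ sum-cong-≗ (λ x → bit-split (f x) (c x)) ⟩
    sum (λ x → bit (f x ∧ c x) + bit (f x ∧ not (c x)))  ≡⟨ ∑-distrib-+ (bit ∘ before) (bit ∘ after) ⟩
    count before + count after                           ≡⟨ cong (count before +_) (∑-permute (bit ∘ after) μ-permutation) ⟩
    count before + count (after ∘ μ)                     ≡⟨ cong (count before +_) (count-cong after∘μ≗before) ⟩
    count before + count before                          ∎
    where
    open ≡-Reasoning
    c = precedesPartner
    before after : Fin N → Bool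
    before x = f x ∧ c x
    after  x = f x ∧ not (c x)
    μ-permutation : Permutation N N
    μ-permutation = permutation μ μ μ-involutive μ-involutive
    after∘μ≗before : ∀ x → after (μ x) ≡ before x
    after∘μ≗before x = cong₂ _∧_ (f∘μ≗f x) (precedesPartner-μ x)

  balanced-even : ∀ {A : Subset N} → (∀ x → lookup A (μ x) ≡ lookup A x) → parity ∣ A ∣ ≡ 0ℙ
  balanced-even {A} balanced = begin
    parity ∣ A ∣                   ≡⟨ cong parity (∣A∣≡count A) ⟩
    parity (count (lookup A))      ≡⟨ cong parity (count-μ-invariant balanced) ⟩
    parity (half + half)           ≡⟨ parity-double half ⟩
    0ℙ                             ∎
    where
    open ≡-Reasoning
    half = count (λ x → lookup A x ∧ precedesPartner x)

  unbalanced : Subset N → Fin N → Bool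
  unbalanced A x = lookup A x xor lookup A (μ x)

  switchAt : Fin N → Subset N → Subset N
  switchAt w A = A [ w ]≔ lookup A (μ w) [ μ w ]≔ lookup A w

  module _ (w : Fin N) (A : Subset N) where

    private
      A′ = A [ w ]≔ lookup A (μ w)

    lookup-switchAt-self : lookup (switchAt w A) w ≡ lookup A (μ w)
    lookup-switchAt-self = trans (lookup∘update′ (μ-fixfree w ∘ sym) A′ (lookup A w)) (lookup∘update w A (lookup A (μ w)))

    lookup-switchAt-partner : lookup (switchAt w A) (μ w) ≡ lookup A w
    lookup-switchAt-partner = lookup∘update (μ w) A′ (lookup A w)

    lookup-switchAt-other : ∀ {x} → x ≢ w → x ≢ μ w → lookup (switchAt w A) x ≡ lookup A x
    lookup-switchAt-other x≢w x≢μw = trans (lookup∘update′ x≢μw A′ (lookup A w)) (lookup∘update′ x≢w A (lookup A (μ w)))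

  switchAt-involutive : ∀ w A → switchAt w (switchAt w A) ≡ A
  switchAt-involutive w A = lookup-ext pointwise
    where
    B = switchAt w A
    pointwise : ∀ x → lookup (switchAt w B) x ≡ lookup A x
    pointwise x with x ≟ w | x ≟ μ w
    ... | yes refl | _        = trans (lookup-switchAt-self x B) (lookup-switchAt-partner x A)
    ... | no _     | yes refl = trans (lookup-switchAt-partner w B) (lookup-switchAt-self w A)
    ... | no x≢w   | no x≢μw  = trans (lookup-switchAt-other w B x≢w x≢μw) (lookup-switchAt-other w A x≢w x≢μw)

  unbalanced-switchAt : ∀ w A x → unbalanced (switchAt w A) x ≡ unbalanced A x
  unbalanced-switchAt w A x with x ≟ w | x ≟ μ w
  ... | yes refl | _        = trans (cong₂ _xor_ (lookup-switchAt-self x A) (lookup-switchAt-partner x A))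
                                    (xor-comm (lookup A (μ x)) (lookup A x))
  ... | no _     | yes refl rewrite μ-involutive w =
                              trans (cong₂ _xor_ (lookup-switchAt-partner w A) (lookup-switchAt-self w A))
                                    (xor-comm (lookup A w) (lookup A (μ w)))
  ... | no x≢w   | no x≢μw  = cong₂ _xor_ (lookup-switchAt-other w A x≢w x≢μw)
                                          (lookup-switchAt-other w A (x≢μw ∘ μx≡w⇒x≡μw) (x≢w ∘ μ-injective))
    where
    μx≡w⇒x≡μw : μ x ≡ w → x ≡ μ w
    μx≡w⇒x≡μw refl = sym (μ-involutive x)

  switchAt-moves : ∀ {w A} → lookup A (μ w) ≡ not (lookup A w) →
                   TokenMove A (switchAt w A) w (μ w) ⊎ TokenMove A (switchAt w A) (μ w) w
  switchAt-moves {w} {A} A[μw] = by-cases (lookup A w) refl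
    where
    by-cases : ∀ b → lookup A w ≡ b →
               TokenMove A (switchAt w A) w (μ w) ⊎ TokenMove A (switchAt w A) (μ w) w
    by-cases true A[w] = inj₁ record
      { A[u]      = A[w]
      ; B[u]      = trans (lookup-switchAt-self w A) A[μw]≡false
      ; B[v]      = trans (lookup-switchAt-partner w A) A[w]
      ; A[v]      = A[μw]≡false
      ; elsewhere = λ x x≢w x≢μw → sym (lookup-switchAt-other w A x≢w x≢μw)
      }
      where A[μw]≡false = trans A[μw] (cong not A[w])
    by-cases false A[w] = inj₂ record
      { A[u]      = A[μw]≡true
      ; B[u]      = trans (lookup-switchAt-partner w A) A[w]
      ; B[v]      = trans (lookup-switchAt-self w A) A[μw]≡true
      ; A[v]      = A[w]
      ; elsewhere = λ x x≢μw x≢w → sym (lookup-switchAt-other w A x≢w x≢μw)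
      }
      where A[μw]≡true = trans A[μw] (cong not A[w])

  switchFirst : Maybe (Fin N) → Subset N → Subset N
  switchFirst (just w) A = switchAt w A
  switchFirst nothing  A = A

  switch : Subset N → Subset N
  switch A = switchFirst (first (unbalanced A)) A

  switch-involutive : ∀ A → switch (switch A) ≡ A
  switch-involutive A with first (unbalanced A) in eq
  ... | nothing rewrite eq = refl
  ... | just w rewrite first-cong (unbalanced-switchAt w A) | eq = switchAt-involutive w A

  switch-moves : ∀ A → parity ∣ A ∣ ≡ 1ℙ →
                 ∃ λ w → TokenMove A (switch A) w (μ w) ⊎ TokenMove A (switch A) (μ w) w
  switch-moves A odd with first (unbalanced A) in eq
  ... | just w  = w , switchAt-moves (xor≡true⇒≡not (first-just eq))
    where
    xor≡true⇒≡not : ∀ {a b} → a xor b ≡ true → b ≡ not a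
    xor≡true⇒≡not {true}  {false} _ = refl
    xor≡true⇒≡not {false} {true}  _ = refl
  ... | nothing = contradiction (trans (sym odd) (balanced-even {A} balanced)) λ ()
    where
    xor≡false⇒≡ : ∀ {a b} → a xor b ≡ false → b ≡ a
    xor≡false⇒≡ {true}  {true}  _ = refl
    xor≡false⇒≡ {false} {false} _ = refl
    balanced : ∀ x → lookup A (μ x) ≡ lookup A x
    balanced x = xor≡false⇒≡ (first-nothing eq x)

subsetsOfSize : (N k : ℕ) → List (Subset N)
subsetsOfSize zero    zero    = [] ∷ []
subsetsOfSize zero    (suc k) = []
subsetsOfSize (suc N) zero    = map (false ∷_) (subsetsOfSize N zero)
subsetsOfSize (suc N) (suc k) = map (false ∷_) (subsetsOfSize N (suc k)) ++ map (true ∷_) (subsetsOfSize N k)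

length-subsetsOfSize : ∀ N k → length (subsetsOfSize N k) ≡ N C k
length-subsetsOfSize zero    zero    = refl
length-subsetsOfSize zero    (suc k) = refl
length-subsetsOfSize (suc N) zero    = trans (length-map _ (subsetsOfSize N zero)) (length-subsetsOfSize N zero)
length-subsetsOfSize (suc N) (suc k) = begin
  length (map (false ∷_) excluding ++ map (true ∷_) including)
    ≡⟨ length-++ (map (false ∷_) excluding) ⟩
  length (map (false ∷_) excluding) + length (map (true ∷_) including)
    ≡⟨ cong₂ _+_ (length-map _ excluding) (length-map _ including) ⟩
  length excluding + length including
    ≡⟨ cong₂ _+_ (length-subsetsOfSize N (suc k)) (length-subsetsOfSize N k) ⟩
  N C suc k + N C k
    ≡⟨ +-comm (N C suc k) (N C k) ⟩
  N C k + N C suc k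
    ≡⟨ nCk+nC[k+1]≡[n+1]C[k+1] N k ⟩
  suc N C suc k
    ∎
  where
  open ≡-Reasoning
  excluding = subsetsOfSize N (suc k)
  including = subsetsOfSize N k

subsetsOfSize-unique : ∀ N k → Unique (subsetsOfSize N k)
subsetsOfSize-unique zero    zero    = All.[] ∷ []
subsetsOfSize-unique zero    (suc k) = []
subsetsOfSize-unique (suc N) zero    = Unique.map⁺ ∷-injectiveʳ (subsetsOfSize-unique N zero)
subsetsOfSize-unique (suc N) (suc k) =
  Unique.++⁺ (Unique.map⁺ ∷-injectiveʳ (subsetsOfSize-unique N (suc k)))
             (Unique.map⁺ ∷-injectiveʳ (subsetsOfSize-unique N k))
             heads-differ
  where
  heads-differ : ∀ {A} → ¬ (A ∈ map (false ∷_) (subsetsOfSize N (suc k)) × A ∈ map (true ∷_) (subsetsOfSize N k))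
  heads-differ (A∈₁ , A∈₂) with ∈-map⁻ _ A∈₁ | ∈-map⁻ _ A∈₂
  ... | _ , _ , refl | _ , _ , ()

∈-subsetsOfSize⁺ : ∀ {N k} (A : Subset N) → ∣ A ∣ ≡ k → A ∈ subsetsOfSize N k
∈-subsetsOfSize⁺ {zero}  {zero}  []          _    = here refl
∈-subsetsOfSize⁺ {suc N} {zero}  (false ∷ A) ∣A∣≡k = ∈-map⁺ _ (∈-subsetsOfSize⁺ A ∣A∣≡k)
∈-subsetsOfSize⁺ {suc N} {suc k} (false ∷ A) ∣A∣≡k = ∈-++⁺ˡ (∈-map⁺ _ (∈-subsetsOfSize⁺ A ∣A∣≡k))
∈-subsetsOfSize⁺ {suc N} {suc k} (true  ∷ A) ∣A∣≡k =
  ∈-++⁺ʳ (map (false ∷_) (subsetsOfSize N (suc k))) (∈-map⁺ _ (∈-subsetsOfSize⁺ A (cong pred ∣A∣≡k)))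

∈-subsetsOfSize⁻ : ∀ {N k} {A : Subset N} → A ∈ subsetsOfSize N k → ∣ A ∣ ≡ k
∈-subsetsOfSize⁻ {zero}  {zero}  (here refl) = refl
∈-subsetsOfSize⁻ {suc N} {zero}  A∈ with ∈-map⁻ _ A∈
... | _ , A′∈ , refl = ∈-subsetsOfSize⁻ A′∈
∈-subsetsOfSize⁻ {suc N} {suc k} A∈ with ∈-++⁻ (map (false ∷_) (subsetsOfSize N (suc k))) A∈
... | inj₁ A∈₁ with ∈-map⁻ _ A∈₁
...   | _ , A′∈ , refl = ∈-subsetsOfSize⁻ A′∈
∈-subsetsOfSize⁻ {suc N} {suc k} A∈ | inj₂ A∈₂ with ∈-map⁻ _ A∈₂
...   | _ , A′∈ , refl = cong suc (∈-subsetsOfSize⁻ A′∈)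

unique-⊆⇒length≤ : ∀ {a} {X : Set a} {xs ys : List X} → Unique xs → xs ⊆ ys → length xs ≤ length ys
unique-⊆⇒length≤ {xs = []}     _             _     = z≤n
unique-⊆⇒length≤ {xs = x ∷ xs} (x∉xs ∷ xs!) xs⊆ys with ∈-∃++ (xs⊆ys (here refl))
... | ys₁ , ys₂ , refl =
  subst (suc (length xs) ≤_) (sym (length-++-sucʳ ys₁ x ys₂)) (s≤s (unique-⊆⇒length≤ xs! xs⊆ys₁++ys₂))
  where
  xs⊆ys₁++ys₂ : xs ⊆ ys₁ ++ ys₂
  xs⊆ys₁++ys₂ y∈xs with ∈-++⁻ ys₁ (xs⊆ys (there y∈xs))
  ... | inj₁ y∈ys₁         = ∈-++⁺ˡ y∈ys₁
  ... | inj₂ (here refl)   = contradiction refl (All.lookup x∉xs y∈xs)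
  ... | inj₂ (there y∈ys₂) = ∈-++⁺ʳ ys₁ y∈ys₂

double≤⇒≤half : ∀ {m n} → m + m ≤ n → m ≤ n / 2
double≤⇒≤half {m} {n} m+m≤n = subst (_≤ n / 2) (m*n/n≡m m 2) (/-monoˡ-≤ 2 (subst (_≤ n) m+m≡m*2 m+m≤n))
  where
  m+m≡m*2 : m + m ≡ m * 2
  m+m≡m*2 = trans (cong (m +_) (sym (+-identityʳ m))) (*-comm 2 m)

half+half≤ : ∀ n → n / 2 + n / 2 ≤ n
half+half≤ n = subst (_≤ n) (trans (*-comm (n / 2) 2) (cong (n / 2 +_) (+-identityʳ (n / 2)))) (m/n*n≤m n 2)

module _ {N} (G : Graph N) {k} (φ : Subset N → Subset N) (φ-involutive : ∀ A → φ (φ A) ≡ A)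
         (φ-adjacent : ∀ A → ∣ A ∣ ≡ k → TokenAdj G A (φ A)) where

  adjacentInvolution⇒independent≤half : ∀ {S} → IndepSetTok G k S → length S ≤ (N C k) / 2
  adjacentInvolution⇒independent≤half {S} independent = double≤⇒≤half (begin
    length S + length S             ≡⟨ cong (length S +_) (length-map φ S) ⟨
    length S + length (map φ S)     ≡⟨ length-++ S ⟨
    length (S ++ map φ S)           ≤⟨ unique-⊆⇒length≤ S++φS-unique S++φS⊆k-subsets ⟩
    length (subsetsOfSize N k)      ≡⟨ length-subsetsOfSize N k ⟩
    N C k                           ∎)
    where
    open ≤-Reasoning
    open IndepSetTok independent
    φ-injective : ∀ {A B} → φ A ≡ φ B → A ≡ B
    φ-injective {A} {B} φA≡φB = trans (sym (φ-involutive A)) (trans (cong φ φA≡φB) (φ-involutive B))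
    S-disjoint-φS : ∀ {B} → ¬ (B ∈ S × B ∈ map φ S)
    S-disjoint-φS (B∈S , B∈φS) with ∈-map⁻ φ B∈φS
    ... | A , A∈S , refl = indep A∈S B∈S (φ-adjacent A (All.lookup tokens A∈S))
    S++φS-unique : Unique (S ++ map φ S)
    S++φS-unique = Unique.++⁺ unique (Unique.map⁺ φ-injective unique) S-disjoint-φS
    S++φS⊆k-subsets : S ++ map φ S ⊆ subsetsOfSize N k
    S++φS⊆k-subsets {B} B∈ with ∈-++⁻ S B∈
    ... | inj₁ B∈S = ∈-subsetsOfSize⁺ B (All.lookup tokens B∈S)
    ... | inj₂ B∈φS with ∈-map⁻ φ B∈φS
    ...   | A , A∈S , refl =
      ∈-subsetsOfSize⁺ (φ A) (trans (sym (tokenAdj-size G (φ-adjacent A ∣A∣≡k))) ∣A∣≡k)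
      where ∣A∣≡k = All.lookup tokens A∈S

module _ {N} (G : Graph N) (M : PerfectMatching G) where
  open PerfectMatching M

  μ-fixfree : ∀ x → μ x ≢ x
  μ-fixfree x μx≡x = Graph.irrefl G (subst (Adj G x) μx≡x (matched x))

  open FixedPointFreeInvolution μ invol μ-fixfree

  switch-adjacent : ∀ A → parity ∣ A ∣ ≡ 1ℙ → TokenAdj G A (switch A)
  switch-adjacent A odd with switch-moves A odd
  ... | w , inj₁ move = move⇒tokenAdj G (matched w) move
  ... | w , inj₂ move = move⇒tokenAdj G (Graph.sym G (matched w)) move

  perfectMatching⇒independent≤half : ∀ {k S} → parity k ≡ 1ℙ → IndepSetTok G k S → length S ≤ (N C k) / 2
  perfectMatching⇒independent≤half k-odd =
    adjacentInvolution⇒independent≤half G switch switch-involutive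
      (λ A ∣A∣≡k → switch-adjacent A (trans (cong parity ∣A∣≡k) k-odd))

module _ {N} (G : Graph N) (c : Fin N → Bool) (proper : ∀ u v → Adj G u v → c u ≢ c v) (k : ℕ) where

  hasColourParity : (p : Parity) (A : Subset N) → Dec (parity (colourCount c A) ≡ p)
  hasColourParity p A = parity (colourCount c A) ≟ℙ p

  colourParityClass : Parity → List (Subset N)
  colourParityClass p = filter (hasColourParity p) (subsetsOfSize N k)

  colourParityClass-independent : ∀ p → IndepSetTok G k (colourParityClass p)
  colourParityClass-independent p = record
    { unique = Unique.filter⁺ (hasColourParity p) (subsetsOfSize-unique N k)
    ; tokens = filter⁺ (hasColourParity p) (All.tabulate ∈-subsetsOfSize⁻)
    ; indep  = λ A∈ B∈ adj →
        let u , v , uv , move = tokenAdj⇒move G adj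
        in move-flips-colourParity move c (proper u v uv) (trans (has-p A∈) (sym (has-p B∈)))
    }
    where
    has-p : ∀ {A} → A ∈ colourParityClass p → parity (colourCount c A) ≡ p
    has-p A∈ = proj₂ (∈-filter⁻ (hasColourParity p) {xs = subsetsOfSize N k} A∈)

  subsetsOfSize⊆colourParityClasses : subsetsOfSize N k ⊆ colourParityClass 0ℙ ++ colourParityClass 1ℙ
  subsetsOfSize⊆colourParityClasses {A} A∈ with parity (colourCount c A) in eq
  ... | 0ℙ = ∈-++⁺ˡ (∈-filter⁺ (hasColourParity 0ℙ) A∈ eq)
  ... | 1ℙ = ∈-++⁺ʳ (colourParityClass 0ℙ) (∈-filter⁺ (hasColourParity 1ℙ) A∈ eq)

  evenColourClass≥half : (∀ {S} → IndepSetTok G k S → length S ≤ (N C k) / 2) →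
                          (N C k) / 2 ≤ length (colourParityClass 0ℙ)
  evenColourClass≥half independent≤half = +-cancelʳ-≤ half half (length evens) (begin
    half + half                 ≤⟨ half+half≤ (N C k) ⟩
    N C k                       ≡⟨ length-subsetsOfSize N k ⟨
    length (subsetsOfSize N k)  ≤⟨ unique-⊆⇒length≤ (subsetsOfSize-unique N k) subsetsOfSize⊆colourParityClasses ⟩
    length (evens ++ odds)      ≡⟨ length-++ evens ⟩
    length evens + length odds  ≤⟨ +-monoʳ-≤ (length evens) (independent≤half (colourParityClass-independent 1ℙ)) ⟩
    length evens + half         ∎)
    where
    open ≤-Reasoning
    half  = (N C k) / 2
    evens = colourParityClass 0ℙ
    odds  = colourParityClass 1ℙ

inFirstPart : ∀ {N} → ℕ → Fin N → Bool
inFirstPart m x = does (toℕ x <ℕ? m)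

bipartite⇒properColouring : ∀ {m n} {G : Graph (m + n)} → IsBipartiteWith m n G →
                            ∀ u v → Adj G u v → inFirstPart m u ≢ inFirstPart m v
bipartite⇒properColouring {m} bipartite u v uv with bipartite u v uv
... | inj₁ (u<m , m≤v) rewrite dec-true (toℕ u <ℕ? m) u<m | dec-false (toℕ v <ℕ? m) (≤⇒≯ m≤v) = λ ()
... | inj₂ (m≤u , v<m) rewrite dec-false (toℕ u <ℕ? m) (≤⇒≯ m≤u) | dec-true (toℕ v <ℕ? m) v<m = λ ()

%2≡1⇒parity≡1ℙ : ∀ k → k % 2 ≡ 1 → parity k ≡ 1ℙ
%2≡1⇒parity≡1ℙ 1             _   = refl
%2≡1⇒parity≡1ℙ (suc (suc k)) odd = %2≡1⇒parity≡1ℙ k odd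

theorem3p6 : (m n k : ℕ) → 1 ≤ m → 1 ≤ n → m ≤ n → 1 ≤ k → k ≤ m + n ∸ 1 →
    (G : Graph (m + n)) → IsBipartiteWith m n G → PerfectMatching G → k % 2 ≡ 1 →
    IndepNumberTok G k (((m + n) C k) / 2)
theorem3p6 m n k _ _ _ _ _ G bipartite M k%2≡1 =
  (evens , evens-independent , ≤-antisym (independent≤half evens-independent) evens-large) ,
  λ _ → independent≤half
  where
  inB : Fin (m + n) → Bool
  inB = inFirstPart m
  proper : ∀ u v → Adj G u v → inB u ≢ inB v
  proper = bipartite⇒properColouring {G = G} bipartite
  independent≤half : ∀ {S} → IndepSetTok G k S → length S ≤ ((m + n) C k) / 2
  independent≤half = perfectMatching⇒independent≤half G M (%2≡1⇒parity≡1ℙ k k%2≡1)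
  evens : List (Subset (m + n))
  evens = colourParityClass G inB proper k 0ℙ
  evens-independent : IndepSetTok G k evens
  evens-independent = colourParityClass-independent G inB proper k 0ℙ
  evens-large : ((m + n) C k) / 2 ≤ length evens
  evens-large = evenColourClass≥half G inB proper k independent≤half
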